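{- Let $p\le q$ be $n$-symmetric lattice paths and let $S=\operatorname{lab}^L(p)\cap[n]$, $T=\operatorname{lab}^L(q)\cap[n]$ (so $\Delta[p,q]=\Delta[S,T]$). Then $[S,T]$ is a linked toric interval if and only if $[p,q]$ is a linked symmetric snake path.
   Context: An $n$-symmetric lattice path is a path from $(0,0)$ to $(n,n)$ of $2n$ unit steps $E=(1,0)$, $N=(0,1)$, a word $\alpha_1\cdots\alpha_{2n}$, invariant under reflection through $y=n-x$ (i.e. $\alpha_i\ne\alpha_{2n-i+1}$ for $i\le n$); $p\le q$ means $p$ lies weakly below $q$. $\operatorname{lab}^L(p)$: label the steps in order by $-n,\dots,-1,1,\dots,n$ and record labels of $E$ steps. $[p,q]$ is a symmetric snake path if the skew diagram (union of unit boxes) between $p$ and $q$ contains no $2\times2$ square of boxes; it is linked if $p,q$ meet only at $(0,0)$ and $(n,n)$. Type $C_n$ Gale order on subsets of $[n]$: for $A=\{a_1<\dots<a_j\}$, $B=\{b_1<\dots<b_k\}$, $A\le B$ iff $j\le k$ and $a_{j-i+1}\le b_{k-i+1}$ for all $i\in[j]$; rank function $\ell(A)=\sum_{a\in A}a$. $\Delta[S,T]$ is the delta matroid with feasible sets $\{R: S\le R\le T\}$, $P(\Delta[S,T])$ the convex hull of their indicator vectors in $\mathbb{R}^n$. $[S,T]$ is linked if $\dim P(\Delta[S,T])=n$, and toric if the associated Lagrangian Richardson variety is toric, equivalently (Tsukerman–Williams) $\ell(T)-\ell(S)=\dim P(\Delta[S,T])$. -}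

module Defs where

open import Data.Nat using (ℕ; zero; suc; _+_; _∸_; _≤_; _<_)
open import Data.Integer as ℤ using (ℤ; +_; -[1+_])
open import Data.Rational using (ℚ; 0ℚ; 1ℚ) renaming (_+_ to _+ℚ_; _*_ to _*ℚ_)
open import Data.Fin using (Fin; zero; suc; toℕ; opposite)
open import Data.Fin.Subset using (Subset)
open import Data.Vec as Vec using (Vec; []; _∷_; lookup; tabulate; toList)
open import Data.List as List using (List; []; _∷_; _++_; take; reverse; concatMap; allFin)
open import Data.Nat.ListAction using (sum)
open import Data.List.Membership.DecPropositional ℤ._≟_ using (_∈?_)
open import Data.Bool using (Bool; true; false; if_then_else_)
open import Data.Product using (Σ; ∃; _×_; _,_)
open import Data.Sum using (_⊎_)
open import Data.Unit using (⊤)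
open import Data.Empty using (⊥)
open import Relation.Nullary using (¬_; does)
open import Relation.Binary.PropositionalEquality using (_≡_; _≢_)

data Step : Set where
  E N : Step

Path : ℕ → Set
Path n = Vec Step (n + n)

isE : Step → Bool
isE E = true
isE N = false

countE countN : List Step → ℕ
countE [] = 0
countE (E ∷ w) = suc (countE w)
countE (N ∷ w) = countE w
countN [] = 0
countN (E ∷ w) = countN w
countN (N ∷ w) = suc (countN w)

point : ∀ {n} → Path n → ℕ → ℕ × ℕ
point p k = countE (take k (toList p)) , countN (take k (toList p))

-- n-symmetric: α_i ≠ α_{2n-i+1} for i ≤ n (1-indexed); here 0-indexed,
-- position i is paired with position (2n-1-i) = opposite i.
Symmetric : ∀ {n} → Path n → Set
Symmetric {n} p = ∀ (i : Fin (n + n)) → toℕ i < n → lookup p i ≢ lookup p (opposite i)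

_≤P_ : ∀ {n} → Path n → Path n → Set
_≤P_ {n} p q = ∀ k → k ≤ n + n → countN (take k (toList p)) ≤ countN (take k (toList q))

-- Labels: steps (0-indexed position i) labelled -n,…,-1,1,…,n in order.

labelOf : ∀ {n} → Fin (n + n) → ℤ
labelOf {n} i with toℕ i Data.Nat.<? n
... | Relation.Nullary.yes _ = -[1+ (n ∸ suc (toℕ i)) ]
... | Relation.Nullary.no _  = + suc (toℕ i ∸ n)
  where import Data.Nat

labL : ∀ {n} → Path n → List ℤ
labL {n} p = concatMap (λ i → if isE (lookup p i) then labelOf {n} i ∷ [] else [])
                       (allFin (n + n))

-- subsets of [n] are encoded as Subset n; position j ∈ Fin n stands for j+1
-- lab^L(p) ∩ [n]
labSet : ∀ {n} → Path n → Subset n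
labSet {n} p = tabulate (λ j → does (+ suc (toℕ j) ∈? labL {n} p))

elems : ∀ {n} → Subset n → List ℕ
elems [] = []
elems (b ∷ bs) = (if b then 1 ∷ [] else []) ++ List.map suc (elems bs)

rank : ∀ {n} → Subset n → ℕ
rank A = sum (elems A)

-- comparison of decreasing element lists: a_{j-i+1} ≤ b_{k-i+1}, j ≤ k
data GaleDesc : List ℕ → List ℕ → Set where
  nil  : ∀ {bs} → GaleDesc [] bs
  cons : ∀ {a b as bs} → a ≤ b → GaleDesc as bs → GaleDesc (a ∷ as) (b ∷ bs)

_≤G_ : ∀ {n} → Subset n → Subset n → Set
A ≤G B = GaleDesc (reverse (elems A)) (reverse (elems B))

Feasible : ∀ {n} → Subset n → Subset n → Subset n → Set
Feasible S T R = (S ≤G R) × (R ≤G T)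

Σℚ : ∀ {m} → (Fin m → ℚ) → ℚ
Σℚ {zero} c = 0ℚ
Σℚ {suc m} c = c zero +ℚ Σℚ (λ j → c (suc j))

indicator : ∀ {n} → Subset n → Fin n → ℚ
indicator R i = if lookup R i then 1ℚ else 0ℚ

AffinelyIndependent : ∀ {n m} → (Fin m → Subset n) → Set
AffinelyIndependent {n} {m} v =
  ∀ (c : Fin m → ℚ) → Σℚ c ≡ 0ℚ →
  (∀ (i : Fin n) → Σℚ (λ j → c j *ℚ indicator (v j) i) ≡ 0ℚ) →
  ∀ j → c j ≡ 0ℚ

HasDim : ∀ {n} → (Subset n → Set) → ℕ → Set
HasDim {n} F d =
  (Σ (Fin (suc d) → Subset n) λ v → (∀ j → F (v j)) × AffinelyIndependent v)
  × (∀ (v : Fin (suc (suc d)) → Subset n) → (∀ j → F (v j)) → ¬ AffinelyIndependent v)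

LinkedInterval : ∀ {n} → Subset n → Subset n → Set
LinkedInterval {n} S T = HasDim (Feasible S T) n

ToricInterval : ∀ {n} → Subset n → Subset n → Set
ToricInterval S T = Σ ℕ λ d → HasDim (Feasible S T) d × rank T ≡ rank S + d

-- height of the (x+1)-th E step (x-th column, 0-indexed)
colH : List Step → ℕ → ℕ
colH [] x = 0
colH (N ∷ w) x = suc (colH w x)
colH (E ∷ w) zero = 0
colH (E ∷ w) (suc x) = colH w x

-- the unit box with lower-left corner (x,y) lies between p and q
InBox : ∀ {n} → Path n → Path n → ℕ → ℕ → Set
InBox {n} p q x y = x < n × colH (toList p) x ≤ y × suc y ≤ colH (toList q) x

SnakePath : ∀ {n} → Path n → Path n → Set
SnakePath {n} p q = ¬ (Σ ℕ λ x → Σ ℕ λ y →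
  InBox {n} p q x y × InBox {n} p q (suc x) y × InBox {n} p q x (suc y) × InBox {n} p q (suc x) (suc y))

LinkedPaths : ∀ {n} → Path n → Path n → Set
LinkedPaths {n} p q = ∀ j k → j ≤ n + n → k ≤ n + n → point {n} p j ≡ point {n} q k →
  point {n} p j ≡ (0 , 0) ⊎ point {n} p j ≡ (n , n)

module Submission where

-- Both conditions say that S and T differ only in the largest element n, i.e. T = S ∪ {n}.
--
-- Write c_k(R) = #{r ∈ R | r > k}; the Gale order is dominance of these counts, and
-- ℓ(R) = ∑_{k<n} c_k(R). If c_k(S) = c_k(T) for some k < n, every feasible set lies on the hyperplane
-- c_k = c_k(S), so [S,T] is not linked. Hence linked intervals have c_k(S) < c_k(T) for all k < n, so
-- ℓ(T) - ℓ(S) ≥ n ≥ dim P(Δ[S,T]), with equality (toric) exactly when c_k(T) = c_k(S) + 1 for all k,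
-- that is T = S ∪ {n}. Conversely, for such S, T an explicit family of n + 1 feasible sets is
-- affinely independent.
--
-- Paths. p and q meet only at their ends iff q stays strictly above p, and the skew diagram has no
-- 2 × 2 square iff q is never two units higher than p; so [p,q] is a linked snake path iff q is
-- exactly one unit above p at every interior time, iff q is p with its first step E and last step N
-- exchanged. The set lab^L(p) ∩ [n] records the second half of p, which by symmetry determines p,
-- and in these terms exchanging the end steps says exactly T = S ∪ {n}.

open import Defs
open import Algebra.Bundles using (CommutativeRing)
open import Data.Bool using (Bool; true; false; not; if_then_else_)
open import Data.Fin as Fin using (Fin; zero; suc; toℕ; fromℕ<; punchIn; opposite; _↑ˡ_; _↑ʳ_; splitAt; join)
open import Data.Fin.Properties
  using (any?; toℕ-fromℕ<; toℕ<n; toℕ-injective; toℕ-↑ˡ; toℕ-↑ʳ; opposite-prop; opposite-involutive;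
         join-splitAt)
import Data.Fin.Permutation as Permutation
open import Data.Fin.Subset using (Subset)
open import Data.Integer using (ℤ)
import Data.Integer as ℤ
import Data.Integer.Properties as ℤ
open import Data.List using (List; []; _∷_; _++_; reverse; map; length; take; allFin)
open import Data.List.Membership.Propositional using (_∈_; lose)
open import Data.List.Membership.Propositional.Properties using (∈-concatMap⁺; ∈-concatMap⁻; ∈-allFin)
open import Data.List.Membership.DecPropositional ℤ._≟_ using (_∈?_)
open import Data.List.Properties using (reverse-++; reverse-map; unfold-reverse; length-map; length-take; take-all)
open import Data.List.Relation.Unary.All as All using (All; []; _∷_)
import Data.List.Relation.Unary.All.Properties as All
open import Data.List.Relation.Unary.AllPairs as AllPairs using (AllPairs; []; _∷_)
import Data.List.Relation.Unary.AllPairs.Properties as AllPairs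
open import Data.List.Relation.Unary.Any using (here; satisfied)
open import Data.Nat using (ℕ; zero; suc; _+_; _∸_; _≤_; _<_; _>_; _⊓_; ⌊_/2⌋; s≤s; s≤s⁻¹; z≤n)
open import Data.Nat.ListAction using () renaming (sum to sumList)
open import Data.Nat.Properties
import Data.Nat.Solver
open import Data.Product using (Σ; ∃; _×_; _,_; proj₁; proj₂)
open import Data.Rational using (ℚ; 0ℚ; 1ℚ; _-_; -_; 1/_; ≢-nonZero) renaming (_+_ to _+ℚ_; _*_ to _*ℚ_)
import Data.Rational.Properties as ℚ
open import Data.Rational.Solver using (module +-*-Solver)
open import Data.Sum using (_⊎_; inj₁; inj₂)
open import Data.Vec using (Vec; []; _∷_; lookup; toList)
open import Data.Vec.Functional using (insertAt)
open import Data.Vec.Functional.Properties using (insertAt-lookup; insertAt-punchIn)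
open import Data.Vec.Properties using (length-toList; lookup∘tabulate)
open import Function.Bundles using (_⇔_; mk⇔; Equivalence)
open import Function.Properties.Equivalence using (⇔-setoid)
open import Level using (0ℓ)
import Relation.Binary.Reasoning.Setoid as SetoidReasoning
open import Relation.Nullary using (¬_; ¬?; yes; no; does; contradiction)
open import Relation.Nullary.Decidable using (decidable-stable; dec-true; dec-false)
open import Relation.Binary.PropositionalEquality

bit : Bool → ℕ
bit true = 1
bit false = 0

-- #{a ∈ A | a > k}; position i of a subset vector stands for the element i + 1
countAbove : ∀ {n} → ℕ → Subset n → ℕ
countAbove k [] = 0
countAbove zero (b ∷ A) = bit b + countAbove zero A
countAbove (suc k) (b ∷ A) = countAbove k A

countAbove-lookup : ∀ {n} (A : Subset n) (i : Fin n) →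
  countAbove (toℕ i) A ≡ bit (lookup A i) + countAbove (suc (toℕ i)) A
countAbove-lookup (b ∷ A) zero = refl
countAbove-lookup (b ∷ A) (suc i) = countAbove-lookup A i

countAbove-≥ : ∀ {n} k (A : Subset n) → n ≤ k → countAbove k A ≡ 0
countAbove-≥ k [] _ = refl
countAbove-≥ (suc k) (b ∷ A) (s≤s n≤k) = countAbove-≥ k A n≤k

_≼_ : ∀ {n} → Subset n → Subset n → Set
A ≼ B = ∀ k → countAbove k A ≤ countAbove k B

≼-refl : ∀ {n} (A : Subset n) → A ≼ A
≼-refl A k = ≤-refl

∷-≼ : ∀ {n a b} {A B : Subset n} →
  bit a + countAbove 0 A ≤ bit b + countAbove 0 B → A ≼ B → (a ∷ A) ≼ (b ∷ B)
∷-≼ head _ zero = head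
∷-≼ _ tail (suc k) = tail k

∷-mono-≼ : ∀ {n} b {A B : Subset n} → A ≼ B → (b ∷ A) ≼ (b ∷ B)
∷-mono-≼ b A≼B = ∷-≼ (+-monoʳ-≤ (bit b) (A≼B 0)) A≼B

-- Affine dependence of indicator vectors

module AffineDependence where

  open import Algebra.Properties.Semiring.Sum (CommutativeRing.semiring ℚ.+-*-commutativeRing)
  open +-*-Solver

  Σℚ≡sum : ∀ {m} (c : Fin m → ℚ) → Σℚ c ≡ sum c
  Σℚ≡sum {zero} c = refl
  Σℚ≡sum {suc m} c = cong (c zero +ℚ_) (Σℚ≡sum (λ j → c (suc j)))

  Σℚ-cong : ∀ {m} {f g : Fin m → ℚ} → (∀ j → f j ≡ g j) → Σℚ f ≡ Σℚ g
  Σℚ-cong {f = f} {g} f≗g = trans (Σℚ≡sum f) (trans (sum-cong-≗ f≗g) (sym (Σℚ≡sum g)))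

  Σℚ-zero : ∀ {m} {f : Fin m → ℚ} → (∀ j → f j ≡ 0ℚ) → Σℚ f ≡ 0ℚ
  Σℚ-zero {m} f≗0 = trans (Σℚ-cong f≗0) (trans (Σℚ≡sum (λ (_ : Fin m) → 0ℚ)) (sum-replicate-zero m))

  +-cancel-zeroˡ : ∀ {x y} → x ≡ 0ℚ → x +ℚ y ≡ 0ℚ → y ≡ 0ℚ
  +-cancel-zeroˡ {x} {y} x≡0 x+y≡0 = trans (sym (trans (cong (_+ℚ y) x≡0) (ℚ.+-identityˡ y))) x+y≡0

  +-cancel-zeroʳ : ∀ {x y} → y ≡ 0ℚ → x +ℚ y ≡ 0ℚ → x ≡ 0ℚ
  +-cancel-zeroʳ {x} {y} y≡0 x+y≡0 = trans (sym (trans (cong (x +ℚ_) y≡0) (ℚ.+-identityʳ x))) x+y≡0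

  LinearRelation : ∀ {m K} → (Fin m → Fin K → ℚ) → (Fin m → ℚ) → Set
  LinearRelation u c = ∀ i → sum (λ j → c j *ℚ u j i) ≡ 0ℚ

  NonTrivial : ∀ {m} → (Fin m → ℚ) → Set
  NonTrivial c = ∃ λ j → c j ≢ 0ℚ

  -- Putting the coefficient -∑ⱼ cⱼ λⱼ on the pivot vector u p turns a combination of the other
  -- vectors into the same combination of the vectors u (punchIn p j) - λⱼ u p.
  sum-eliminate : ∀ {m K} (u : Fin (suc m) → Fin K → ℚ) (p : Fin (suc m)) (λ′ c : Fin m → ℚ) i →
    let c⁺ = insertAt c p (- sum (λ j → c j *ℚ λ′ j)) in
    sum (λ j → c⁺ j *ℚ u j i) ≡ sum (λ j → c j *ℚ (u (punchIn p j) i - λ′ j *ℚ u p i))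
  sum-eliminate u p λ′ c i = begin
      sum (λ j → c⁺ j *ℚ u j i)
    ≡⟨ sum-remove (λ j → c⁺ j *ℚ u j i) ⟩
      c⁺ p *ℚ b +ℚ sum (λ j → c⁺ (punchIn p j) *ℚ u (punchIn p j) i)
    ≡⟨ cong₂ _+ℚ_ (cong (_*ℚ b) (insertAt-lookup c p x))
                  (sum-cong-≗ (λ j → cong (_*ℚ u (punchIn p j) i) (insertAt-punchIn c p x j))) ⟩
      x *ℚ b +ℚ sum (λ j → c j *ℚ u (punchIn p j) i)
    ≡⟨ cong (_+ℚ sum (λ j → c j *ℚ u (punchIn p j) i))
         (trans (solve 2 (λ s b → (:- s) :* b := s :* (:- b)) refl (sum g) b) (*-distribʳ-sum (- b) g)) ⟩
      sum (λ j → g j *ℚ (- b)) +ℚ sum (λ j → c j *ℚ u (punchIn p j) i)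
    ≡⟨ sym (∑-distrib-+ (λ j → g j *ℚ (- b)) (λ j → c j *ℚ u (punchIn p j) i)) ⟩
      sum (λ j → g j *ℚ (- b) +ℚ c j *ℚ u (punchIn p j) i)
    ≡⟨ sum-cong-≗ (λ j → solve 4 (λ c l b y → c :* l :* (:- b) :+ c :* y := c :* (y :- l :* b))
                           refl (c j) (λ′ j) b (u (punchIn p j) i)) ⟩
      sum (λ j → c j *ℚ (u (punchIn p j) i - λ′ j *ℚ b)) ∎
    where
    open ≡-Reasoning
    g = λ j → c j *ℚ λ′ j
    x = - sum g
    c⁺ = insertAt c p x
    b = u p i

  -- one step of Gaussian elimination, with pivot entry u p zero
  module Elimination {m K} (u : Fin (suc m) → Fin (suc K) → ℚ) (p : Fin (suc m)) (a≢0 : u p zero ≢ 0ℚ) where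

    instance
      pivotNonZero = ≢-nonZero a≢0

    ratio : Fin m → ℚ
    ratio j = u (punchIn p j) zero *ℚ 1/ u p zero

    reduced : Fin m → Fin K → ℚ
    reduced j i = u (punchIn p j) (suc i) - ratio j *ℚ u p (suc i)

    ratio-cancels : ∀ j → u (punchIn p j) zero - ratio j *ℚ u p zero ≡ 0ℚ
    ratio-cancels j = begin
        y - y *ℚ 1/ a *ℚ a
      ≡⟨ cong (λ z → y - z)
           (trans (ℚ.*-assoc y (1/ a) a) (trans (cong (y *ℚ_) (ℚ.*-inverseˡ a)) (ℚ.*-identityʳ y))) ⟩
        y - y
      ≡⟨ ℚ.+-inverseʳ y ⟩
        0ℚ ∎
      where
      open ≡-Reasoning
      a = u p zero
      y = u (punchIn p j) zero

    lift : (∃ λ c → LinearRelation reduced c × NonTrivial c) → ∃ λ c → LinearRelation u c × NonTrivial c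
    lift (c , relation , j , cj≢0) =
      c⁺ , relation⁺ , punchIn p j , λ c⁺ⱼ≡0 → cj≢0 (trans (sym (insertAt-punchIn c p _ j)) c⁺ⱼ≡0)
      where
      c⁺ = insertAt c p (- sum (λ j → c j *ℚ ratio j))
      relation⁺ : LinearRelation u c⁺
      relation⁺ zero = trans (sum-eliminate u p ratio c zero)
        (trans (sum-cong-≗ (λ j → trans (cong (c j *ℚ_) (ratio-cancels j)) (ℚ.*-zeroʳ (c j))))
               (sum-replicate-zero m))
      relation⁺ (suc i) = trans (sum-eliminate u p ratio c (suc i)) (relation i)

  more-vectors⇒dependent : ∀ {K m} → K < m → (u : Fin m → Fin K → ℚ) → ∃ λ c → LinearRelation u c × NonTrivial c
  more-vectors⇒dependent {zero} {suc m} _ u = (λ _ → 1ℚ) , (λ ()) , zero , λ ()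
  more-vectors⇒dependent {suc K} {suc m} (s≤s K<m) u with any? (λ j → ¬? (u j zero ℚ.≟ 0ℚ))
  ... | yes (p , a≢0) = Elimination.lift u p a≢0 (more-vectors⇒dependent K<m (Elimination.reduced u p a≢0))
  ... | no noPivot with more-vectors⇒dependent (m<n⇒m<1+n K<m) (λ j i → u j (suc i))
  ...   | c , relation , nonTrivial = c , relation⁺ , nonTrivial
    where
    relation⁺ : LinearRelation u c
    relation⁺ zero = trans (sum-cong-≗ λ j →
        trans (cong (c j *ℚ_) (decidable-stable (u j zero ℚ.≟ 0ℚ) (λ ne → noPivot (j , ne)))) (ℚ.*-zeroʳ (c j)))
      (sum-replicate-zero (suc m))
    relation⁺ (suc i) = relation i

  toℚ : ℕ → ℚ
  toℚ zero = 0ℚ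
  toℚ (suc n) = 1ℚ +ℚ toℚ n

  indicator-countAbove : ∀ {n} (A : Subset n) (i : Fin n) →
    indicator A i ≡ toℚ (countAbove (toℕ i) A) - toℚ (countAbove (suc (toℕ i)) A)
  indicator-countAbove A i =
    trans (bit-difference (lookup A i) _)
          (cong (λ c → toℚ c - toℚ (countAbove (suc (toℕ i)) A)) (sym (countAbove-lookup A i)))
    where
    bit-difference : ∀ b x → (if b then 1ℚ else 0ℚ) ≡ toℚ (bit b + x) - toℚ x
    bit-difference true x = solve 1 (λ y → con 1ℚ := con 1ℚ :+ y :- y) refl (toℚ x)
    bit-difference false x = sym (ℚ.+-inverseʳ (toℚ x))

  relation⇒¬independent : ∀ {n m} (v : Fin m → Subset n) (c : Fin m → ℚ) → NonTrivial c → sum c ≡ 0ℚ →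
    (∀ i → sum (λ j → c j *ℚ indicator (v j) i) ≡ 0ℚ) → ¬ AffinelyIndependent v
  relation⇒¬independent v c (j , cj≢0) total coordinates independent =
    cj≢0 (independent c (trans (Σℚ≡sum c) total)
                        (λ i → trans (Σℚ≡sum (λ j → c j *ℚ indicator (v j) i)) (coordinates i)) j)

  n+2-points⇒¬independent : ∀ {n m} → suc n < m → (v : Fin m → Subset n) → ¬ AffinelyIndependent v
  n+2-points⇒¬independent {n} lt v with more-vectors⇒dependent lt homogeneous
    where
    homogeneous : _ → Fin (suc n) → ℚ
    homogeneous j zero = 1ℚ
    homogeneous j (suc i) = indicator (v j) i
  ... | c , relation , nonTrivial = relation⇒¬independent v c nonTrivial
    (trans (sum-cong-≗ (λ j → sym (ℚ.*-identityʳ (c j)))) (relation zero)) (λ i → relation (suc i))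

  hyperplaneCoordinates : ∀ {n m} → Fin n → (Fin m → Subset n) → Fin m → Fin n → ℚ
  hyperplaneCoordinates k v j i with i Fin.≟ k
  ... | yes _ = 1ℚ
  ... | no _ = toℚ (countAbove (toℕ i) (v j))

  countAbove-relation⇒indicator-relation : ∀ {n m} (v : Fin m → Subset n) (c : Fin m → ℚ) →
    (∀ t → t < n → sum (λ j → c j *ℚ toℚ (countAbove t (v j))) ≡ 0ℚ) →
    ∀ i → sum (λ j → c j *ℚ indicator (v j) i) ≡ 0ℚ
  countAbove-relation⇒indicator-relation {n} {m} v c relation i = begin
      sum (λ j → c j *ℚ indicator (v j) i)
    ≡⟨ sum-cong-≗ (λ j → trans (cong (c j *ℚ_) (indicator-countAbove (v j) i))
         (solve 3 (λ c a b → c :* (a :- b) := c :* a :+ c :* b :* con (- 1ℚ))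
                refl (c j) (toℚ (countAbove t (v j))) (toℚ (countAbove (suc t) (v j))))) ⟩
      sum (λ j → above t j +ℚ above (suc t) j *ℚ (- 1ℚ))
    ≡⟨ ∑-distrib-+ (above t) (λ j → above (suc t) j *ℚ (- 1ℚ)) ⟩
      sum (above t) +ℚ sum (λ j → above (suc t) j *ℚ (- 1ℚ))
    ≡⟨ cong (sum (above t) +ℚ_) (sym (*-distribʳ-sum (- 1ℚ) (above (suc t)))) ⟩
      sum (above t) +ℚ sum (above (suc t)) *ℚ (- 1ℚ)
    ≡⟨ cong₂ (λ a b → a +ℚ b *ℚ (- 1ℚ)) (Y≡0 t) (Y≡0 (suc t)) ⟩
      0ℚ ∎
    where
    open ≡-Reasoning
    t = toℕ i
    above : ℕ → Fin m → ℚ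
    above s j = c j *ℚ toℚ (countAbove s (v j))
    Y≡0 : ∀ s → sum (above s) ≡ 0ℚ
    Y≡0 s with s <? n
    ... | yes s<n = relation s s<n
    ... | no s≮n = trans (sum-cong-≗ (λ j → trans (cong (λ x → c j *ℚ toℚ x) (countAbove-≥ s (v j) (≮⇒≥ s≮n)))
                                                  (ℚ.*-zeroʳ (c j))))
                         (sum-replicate-zero m)

  -- the counts countAbove i are affine coordinates, in which the hyperplane is a coordinate hyperplane
  hyperplane⇒¬independent : ∀ {n} (k : Fin n) C (v : Fin (suc n) → Subset n) →
    (∀ j → countAbove (toℕ k) (v j) ≡ C) → ¬ AffinelyIndependent v
  hyperplane⇒¬independent {n} k C v onHyperplane with more-vectors⇒dependent ≤-refl (hyperplaneCoordinates k v)
  ... | c , relation , nonTrivial =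
    relation⇒¬independent v c nonTrivial total (countAbove-relation⇒indicator-relation v c Y≡0)
    where
    open ≡-Reasoning

    Y : ℕ → ℚ
    Y t = sum (λ j → c j *ℚ toℚ (countAbove t (v j)))

    total : sum c ≡ 0ℚ
    total = trans (sum-cong-≗ (λ j → sym (trans (cong (c j *ℚ_) (at-k j)) (ℚ.*-identityʳ (c j))))) (relation k)
      where
      at-k : ∀ j → hyperplaneCoordinates k v j k ≡ 1ℚ
      at-k j with k Fin.≟ k
      ... | yes _ = refl
      ... | no k≢k = contradiction refl k≢k

    Y-at : ∀ (i : Fin n) → Y (toℕ i) ≡ 0ℚ
    Y-at i with i Fin.≟ k
    ... | yes refl = begin
        sum (λ j → c j *ℚ toℚ (countAbove (toℕ k) (v j)))
      ≡⟨ sum-cong-≗ (λ j → cong (λ x → c j *ℚ toℚ x) (onHyperplane j)) ⟩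
        sum (λ j → c j *ℚ toℚ C)
      ≡⟨ sym (*-distribʳ-sum (toℚ C) c) ⟩
        sum c *ℚ toℚ C
      ≡⟨ cong (_*ℚ toℚ C) total ⟩
        0ℚ *ℚ toℚ C
      ≡⟨ ℚ.*-zeroˡ (toℚ C) ⟩
        0ℚ ∎
    ... | no i≢k = trans (sum-cong-≗ (λ j → cong (c j *ℚ_) (sym (off-k j)))) (relation i)
      where
      off-k : ∀ j → hyperplaneCoordinates k v j i ≡ toℚ (countAbove (toℕ i) (v j))
      off-k j with i Fin.≟ k
      ... | yes i≡k = contradiction i≡k i≢k
      ... | no _ = refl

    Y≡0 : ∀ t → t < n → Y t ≡ 0ℚ
    Y≡0 t t<n = subst (λ s → Y s ≡ 0ℚ) (toℕ-fromℕ< t<n) (Y-at (fromℕ< t<n))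

  point-independent : ∀ {n} (R : Subset n) → AffinelyIndependent (λ (_ : Fin 1) → R)
  point-independent R c total _ zero = +-cancel-zeroʳ refl total

  extend : ∀ {n m} → Bool → Subset n → (Fin m → Subset n) → Fin (suc m) → Subset (suc n)
  extend b R v zero = not b ∷ R
  extend b R v (suc j) = b ∷ v j

  -- the first coordinate separates the vertex not b ∷ R from all the others
  extend-independent : ∀ {n m} b (R : Subset n) {v : Fin m → Subset n} →
    AffinelyIndependent v → AffinelyIndependent (extend b R v)
  extend-independent {m = m} b R {v} independent c total coordinates = λ
    { zero → proj₁ first-coordinate
    ; (suc j) → independent c′ (proj₂ first-coordinate) other-coordinates j }
    where
    c′ : Fin m → ℚ
    c′ j = c (suc j)
    first : ∀ b → Σℚ (λ j → c j *ℚ indicator (extend b R v j) zero) ≡ 0ℚ → c zero ≡ 0ℚ × Σℚ c′ ≡ 0ℚ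
    first true h = +-cancel-zeroʳ Σc′≡0 total , Σc′≡0
      where
      Σc′≡0 = +-cancel-zeroˡ (ℚ.*-zeroʳ (c zero))
        (trans (cong (c zero *ℚ 0ℚ +ℚ_) (sym (Σℚ-cong (λ j → ℚ.*-identityʳ (c′ j))))) h)
    first false h = c₀≡0 , +-cancel-zeroˡ c₀≡0 total
      where
      c₀≡0 = trans (sym (ℚ.*-identityʳ (c zero))) (+-cancel-zeroʳ (Σℚ-zero (λ j → ℚ.*-zeroʳ (c′ j))) h)
    first-coordinate = first b (coordinates zero)
    other-coordinates : ∀ i → Σℚ (λ j → c′ j *ℚ indicator (v j) i) ≡ 0ℚ
    other-coordinates i = +-cancel-zeroˡ
      (trans (cong (_*ℚ x) (proj₁ first-coordinate)) (ℚ.*-zeroˡ x))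
      (coordinates (suc i))
      where x = indicator (not b ∷ R) (suc i)

open AffineDependence
  using (n+2-points⇒¬independent; hyperplane⇒¬independent; point-independent; extend; extend-independent)

-- The Gale order as dominance of counts

countAtLeast : ℕ → List ℕ → ℕ
countAtLeast t [] = 0
countAtLeast t (x ∷ xs) with t ≤? x
... | yes _ = suc (countAtLeast t xs)
... | no _ = countAtLeast t xs

countAtLeast-++ : ∀ t xs ys → countAtLeast t (xs ++ ys) ≡ countAtLeast t xs + countAtLeast t ys
countAtLeast-++ t [] ys = refl
countAtLeast-++ t (x ∷ xs) ys with t ≤? x
... | yes _ = cong suc (countAtLeast-++ t xs ys)
... | no _ = countAtLeast-++ t xs ys

countAtLeast-reverse : ∀ t xs → countAtLeast t (reverse xs) ≡ countAtLeast t xs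
countAtLeast-reverse t [] = refl
countAtLeast-reverse t (x ∷ xs) = begin
    countAtLeast t (reverse (x ∷ xs))
  ≡⟨ cong (countAtLeast t) (unfold-reverse x xs) ⟩
    countAtLeast t (reverse xs ++ x ∷ [])
  ≡⟨ countAtLeast-++ t (reverse xs) (x ∷ []) ⟩
    countAtLeast t (reverse xs) + countAtLeast t (x ∷ [])
  ≡⟨ cong (_+ countAtLeast t (x ∷ [])) (countAtLeast-reverse t xs) ⟩
    countAtLeast t xs + countAtLeast t (x ∷ [])
  ≡⟨ +-comm (countAtLeast t xs) _ ⟩
    countAtLeast t (x ∷ []) + countAtLeast t xs
  ≡⟨ head-count t ⟩
    countAtLeast t (x ∷ xs) ∎
  where
  open ≡-Reasoning
  head-count : ∀ t → countAtLeast t (x ∷ []) + countAtLeast t xs ≡ countAtLeast t (x ∷ xs)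
  head-count t with t ≤? x
  ... | yes _ = refl
  ... | no _ = refl

countAtLeast-map-suc : ∀ t xs → countAtLeast (suc t) (map suc xs) ≡ countAtLeast t xs
countAtLeast-map-suc t [] = refl
countAtLeast-map-suc t (x ∷ xs) with suc t ≤? suc x | t ≤? x
... | yes _ | yes _ = cong suc (countAtLeast-map-suc t xs)
... | no _ | no _ = countAtLeast-map-suc t xs
... | yes t+1≤x+1 | no t≰x = contradiction (s≤s⁻¹ t+1≤x+1) t≰x
... | no t+1≰x+1 | yes t≤x = contradiction (s≤s t≤x) t+1≰x+1

countAtLeast-0-map-suc : ∀ xs → countAtLeast 0 (map suc xs) ≡ countAtLeast 0 xs
countAtLeast-0-map-suc [] = refl
countAtLeast-0-map-suc (x ∷ xs) = cong suc (countAtLeast-0-map-suc xs)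

-- elements are positive, so the thresholds t = 0 and t = 1 agree
countAtLeast-elems : ∀ {n} t (A : Subset n) → countAtLeast t (elems A) ≡ countAbove (t ∸ 1) A
countAtLeast-elems t [] = refl
countAtLeast-elems zero (true ∷ A) = cong suc (trans (countAtLeast-0-map-suc (elems A)) (countAtLeast-elems 0 A))
countAtLeast-elems zero (false ∷ A) = trans (countAtLeast-0-map-suc (elems A)) (countAtLeast-elems 0 A)
countAtLeast-elems (suc zero) (true ∷ A) = cong suc (trans (countAtLeast-map-suc 0 (elems A)) (countAtLeast-elems 0 A))
countAtLeast-elems (suc zero) (false ∷ A) = trans (countAtLeast-map-suc 0 (elems A)) (countAtLeast-elems 0 A)
countAtLeast-elems (suc (suc t)) (true ∷ A) = trans (countAtLeast-map-suc (suc t) (elems A)) (countAtLeast-elems (suc t) A)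
countAtLeast-elems (suc (suc t)) (false ∷ A) = trans (countAtLeast-map-suc (suc t) (elems A)) (countAtLeast-elems (suc t) A)

countAtLeast-head : ∀ {t x} xs → t ≤ x → countAtLeast t (x ∷ xs) ≡ suc (countAtLeast t xs)
countAtLeast-head {t} {x} xs t≤x with t ≤? x
... | yes _ = refl
... | no t≰x = contradiction t≤x t≰x

countAtLeast-below : ∀ {t xs} → All (_< t) xs → countAtLeast t xs ≡ 0
countAtLeast-below [] = refl
countAtLeast-below {t} {x ∷ xs} (x<t ∷ xs<t) with t ≤? x
... | yes t≤x = contradiction t≤x (<⇒≱ x<t)
... | no _ = countAtLeast-below xs<t

Decreasing : List ℕ → Set
Decreasing = AllPairs _>_

countAtLeast-below-head : ∀ {t a as} → All (_< a) as → a < t → countAtLeast t as ≡ 0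
countAtLeast-below-head as<a a<t = countAtLeast-below (All.map (λ x<a → <-trans x<a a<t) as<a)

galeDesc⇒counts : ∀ {xs ys} → Decreasing xs → GaleDesc xs ys → ∀ t → countAtLeast t xs ≤ countAtLeast t ys
galeDesc⇒counts _ nil t = z≤n
galeDesc⇒counts {a ∷ as} {b ∷ bs} (as<a ∷ dec) (cons a≤b g) t with t ≤? a
... | yes t≤a = subst (suc (countAtLeast t as) ≤_) (sym (countAtLeast-head bs (≤-trans t≤a a≤b)))
                      (s≤s (galeDesc⇒counts dec g t))
... | no t≰a = ≤-trans (≤-reflexive (countAtLeast-below-head as<a (≰⇒> t≰a))) z≤n

counts⇒galeDesc : ∀ {xs ys} → Decreasing xs → Decreasing ys →
  (∀ t → countAtLeast t xs ≤ countAtLeast t ys) → GaleDesc xs ys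
counts⇒galeDesc {[]} _ _ _ = nil
counts⇒galeDesc {a ∷ as} {[]} _ _ counts =
  contradiction (subst (_≤ 0) (countAtLeast-head {a} as ≤-refl) (counts a)) λ ()
counts⇒galeDesc {a ∷ as} {b ∷ bs} (as<a ∷ decX) (bs<b ∷ decY) counts =
  cons a≤b (counts⇒galeDesc decX decY tail-counts)
  where
  a≤b : a ≤ b
  a≤b with a ≤? b
  ... | yes a≤b = a≤b
  ... | no a≰b = contradiction
    (subst₂ _≤_ (countAtLeast-head {a} as ≤-refl) (countAtLeast-below (b<a ∷ All.map (λ x<b → <-trans x<b b<a) bs<b))
                (counts a))
    λ ()
    where b<a = ≰⇒> a≰b
  tail-counts : ∀ t → countAtLeast t as ≤ countAtLeast t bs
  tail-counts t with t ≤? a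
  ... | yes t≤a =
    s≤s⁻¹ (subst₂ _≤_ (countAtLeast-head as t≤a) (countAtLeast-head bs (≤-trans t≤a a≤b)) (counts t))
  ... | no t≰a = ≤-trans (≤-reflexive (countAtLeast-below-head as<a (≰⇒> t≰a))) z≤n

reverse-elems : ∀ {n} b (A : Subset n) →
  reverse (elems (b ∷ A)) ≡ map suc (reverse (elems A)) ++ (if b then 1 ∷ [] else [])
reverse-elems b A = trans (reverse-++ (if b then 1 ∷ [] else []) (map suc (elems A)))
                          (cong₂ _++_ (sym (reverse-map suc (elems A))) (reverse-bit b))
  where
  reverse-bit : ∀ b → reverse (if b then 1 ∷ [] else []) ≡ (if b then 1 ∷ [] else [])
  reverse-bit true = refl
  reverse-bit false = refl

positive-reverse-elems : ∀ {n} (A : Subset n) → All (0 <_) (reverse (elems A))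
positive-reverse-elems [] = []
positive-reverse-elems (b ∷ A) rewrite reverse-elems b A =
  All.++⁺ (All.map⁺ (All.universal (λ _ → s≤s z≤n) (reverse (elems A)))) (positive-bit b)
  where
  positive-bit : ∀ b → All (0 <_) (if b then 1 ∷ [] else [])
  positive-bit true = s≤s z≤n ∷ []
  positive-bit false = []

decreasing-reverse-elems : ∀ {n} (A : Subset n) → Decreasing (reverse (elems A))
decreasing-reverse-elems [] = []
decreasing-reverse-elems (b ∷ A) rewrite reverse-elems b A =
  AllPairs.++⁺ (AllPairs.map⁺ (AllPairs.map s≤s (decreasing-reverse-elems A))) (decreasing-bit b) (above-bit b)
  where
  decreasing-bit : ∀ b → Decreasing (if b then 1 ∷ [] else [])
  decreasing-bit true = [] ∷ []
  decreasing-bit false = []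
  above-bit : ∀ b → All (λ x → All (x >_) (if b then 1 ∷ [] else [])) (map suc (reverse (elems A)))
  above-bit true = All.map⁺ (All.map (λ 0<y → s≤s 0<y ∷ []) (positive-reverse-elems A))
  above-bit false = All.universal (λ _ → []) _

countAtLeast-reverse-elems : ∀ {n} t (A : Subset n) → countAtLeast t (reverse (elems A)) ≡ countAbove (t ∸ 1) A
countAtLeast-reverse-elems t A = trans (countAtLeast-reverse t (elems A)) (countAtLeast-elems t A)

gale⇔≼ : ∀ {n} (A B : Subset n) → A ≤G B ⇔ A ≼ B
gale⇔≼ A B = mk⇔
  (λ A≤B k → subst₂ _≤_ (countAtLeast-reverse-elems (suc k) A) (countAtLeast-reverse-elems (suc k) B)
                        (galeDesc⇒counts (decreasing-reverse-elems A) A≤B (suc k)))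
  (λ dominates → counts⇒galeDesc (decreasing-reverse-elems A) (decreasing-reverse-elems B)
     (λ t → subst₂ _≤_ (sym (countAtLeast-reverse-elems t A)) (sym (countAtLeast-reverse-elems t B))
                       (dominates (t ∸ 1))))

-- Rank and the intervals [S, S ∪ {n}]

open import Algebra.Properties.CommutativeMonoid.Sum +-0-commutativeMonoid
  using (sum; sum-cong-≗; ∑-distrib-+; ∑-permute)

sum-map-suc : ∀ xs → sumList (map suc xs) ≡ length xs + sumList xs
sum-map-suc [] = refl
sum-map-suc (x ∷ xs) = trans (cong (suc x +_) (sum-map-suc xs))
  (solve 3 (λ x l s → (con 1 :+ x) :+ (l :+ s) := (con 1 :+ l) :+ (x :+ s)) refl x (length xs) (sumList xs))
  where open Data.Nat.Solver.+-*-Solver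

length-elems : ∀ {n} (A : Subset n) → length (elems A) ≡ countAbove 0 A
length-elems [] = refl
length-elems (true ∷ A) = cong suc (trans (length-map suc (elems A)) (length-elems A))
length-elems (false ∷ A) = trans (length-map suc (elems A)) (length-elems A)

rank-∷ : ∀ {n} b (A : Subset n) → rank (b ∷ A) ≡ bit b + (countAbove 0 A + rank A)
rank-∷ true A = cong suc (trans (sum-map-suc (elems A)) (cong (_+ rank A) (length-elems A)))
rank-∷ false A = trans (sum-map-suc (elems A)) (cong (_+ rank A) (length-elems A))

rank≡sum-countAbove : ∀ {n} (A : Subset n) → rank A ≡ sum (λ (k : Fin n) → countAbove (toℕ k) A)
rank≡sum-countAbove [] = refl
rank≡sum-countAbove (b ∷ A) =
  trans (rank-∷ b A) (trans (sym (+-assoc (bit b) _ _)) (cong (bit b + countAbove 0 A +_) (rank≡sum-countAbove A)))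


sum-suc : ∀ {m} (f : Fin m → ℕ) → sum (λ i → suc (f i)) ≡ sum f + m
sum-suc {zero} f = refl
sum-suc {suc m} f = trans (cong (suc (f zero) +_) (sum-suc (λ i → f (suc i))))
  (solve 3 (λ a s m → (con 1 :+ a) :+ (s :+ m) := (a :+ s) :+ (con 1 :+ m)) refl (f zero) (sum (λ i → f (suc i))) m)
  where open Data.Nat.Solver.+-*-Solver

sum-mono-≤ : ∀ {m} {f g : Fin m → ℕ} → (∀ i → f i ≤ g i) → sum f ≤ sum g
sum-mono-≤ {zero} f≤g = z≤n
sum-mono-≤ {suc m} f≤g = +-mono-≤ (f≤g zero) (sum-mono-≤ (λ i → f≤g (suc i)))

sum-< : ∀ {m} (f g : Fin m → ℕ) → (∀ i → f i < g i) → sum f + m ≤ sum g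
sum-< f g f<g = subst (_≤ sum g) (sum-suc f) (sum-mono-≤ f<g)

+-tight : ∀ {a b c d} → a ≤ b → c ≤ d → b + d ≤ a + c → b ≡ a × d ≡ c
+-tight {a} {b} {c} {d} a≤b c≤d b+d≤a+c =
  ≤-antisym (+-cancelʳ-≤ c b a (≤-trans (+-monoʳ-≤ b c≤d) b+d≤a+c)) a≤b ,
  ≤-antisym (+-cancelˡ-≤ b d c (≤-trans b+d≤a+c (+-monoˡ-≤ c a≤b))) c≤d

sum-tight : ∀ {m} (f g : Fin m → ℕ) → (∀ i → f i < g i) → sum g ≤ sum f + m → ∀ i → g i ≡ suc (f i)
sum-tight {suc m} f g f<g ∑g≤∑f+m = λ
  { zero → head-tight
  ; (suc i) → sum-tight f′ g′ (λ i → f<g (suc i)) tail-bound i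
  }
  where
  open Data.Nat.Solver.+-*-Solver
  f′ g′ : Fin m → ℕ
  f′ i = f (suc i)
  g′ i = g (suc i)
  tight = +-tight (f<g zero) (sum-< f′ g′ (λ i → f<g (suc i)))
    (subst (g zero + sum g′ ≤_)
      (solve 3 (λ a s m → (a :+ s) :+ (con 1 :+ m) := (con 1 :+ a) :+ (s :+ m)) refl (f zero) (sum f′) m)
      ∑g≤∑f+m)
  head-tight = proj₁ tight
  tail-bound = ≤-reflexive (proj₂ tight)

-- AddsTop S T : T = S ∪ {n} with n ∉ S
data AddsTop : ∀ {n} → Subset n → Subset n → Set where
  top : AddsTop (false ∷ []) (true ∷ [])
  _∷_ : ∀ {n} b {S T : Subset (suc n)} → AddsTop S T → AddsTop (b ∷ S) (b ∷ T)

OneMoreAbove : ∀ {n} → Subset n → Subset n → Set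
OneMoreAbove {n} S T = ∀ k → k < n → countAbove k T ≡ suc (countAbove k S)

addsTop⇒oneMoreAbove : ∀ {n} {S T : Subset n} → AddsTop S T → OneMoreAbove S T
addsTop⇒oneMoreAbove top zero _ = refl
addsTop⇒oneMoreAbove top (suc k) (s≤s ())
addsTop⇒oneMoreAbove (b ∷ t) zero _ = trans (cong (bit b +_) (addsTop⇒oneMoreAbove t 0 (s≤s z≤n))) (+-suc (bit b) _)
addsTop⇒oneMoreAbove (b ∷ t) (suc k) (s≤s k<n) = addsTop⇒oneMoreAbove t k k<n

bit-injective : ∀ {a b} → bit a ≡ bit b → a ≡ b
bit-injective {true} {true} _ = refl
bit-injective {false} {false} _ = refl

oneMoreAbove⇒addsTop : ∀ {m} (S T : Subset (suc m)) → OneMoreAbove S T → AddsTop S T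
oneMoreAbove⇒addsTop {zero} (false ∷ []) (true ∷ []) _ = top
oneMoreAbove⇒addsTop {zero} (false ∷ []) (false ∷ []) h = contradiction (h 0 (s≤s z≤n)) λ ()
oneMoreAbove⇒addsTop {zero} (true ∷ []) (true ∷ []) h = contradiction (h 0 (s≤s z≤n)) λ ()
oneMoreAbove⇒addsTop {zero} (true ∷ []) (false ∷ []) h = contradiction (h 0 (s≤s z≤n)) λ ()
oneMoreAbove⇒addsTop {suc m} (s ∷ S) (t ∷ T) h =
  subst (λ b → AddsTop (s ∷ S) (b ∷ T)) (bit-injective same-bit) (s ∷ oneMoreAbove⇒addsTop S T tail)
  where
  tail : OneMoreAbove S T
  tail k k<n = h (suc k) (s≤s k<n)
  same-bit : bit s ≡ bit t
  same-bit = +-cancelʳ-≡ (suc (countAbove 0 S)) (bit s) (bit t) (begin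
      bit s + suc (countAbove 0 S)
    ≡⟨ +-suc (bit s) _ ⟩
      suc (bit s + countAbove 0 S)
    ≡⟨ sym (h 0 (s≤s z≤n)) ⟩
      bit t + countAbove 0 T
    ≡⟨ cong (bit t +_) (tail 0 (s≤s z≤n)) ⟩
      bit t + suc (countAbove 0 S) ∎)
    where open ≡-Reasoning

addsTop⇒≼ : ∀ {n} {S T : Subset n} → AddsTop S T → S ≼ T
addsTop⇒≼ top zero = z≤n
addsTop⇒≼ top (suc k) = z≤n
addsTop⇒≼ (b ∷ t) = ∷-mono-≼ b (addsTop⇒≼ t)

vertices : ∀ {n} {S T : Subset n} → AddsTop S T → Fin (suc n) → Subset n
vertices top = extend true [] (λ _ → [])
vertices (_∷_ true {T = T} t) = extend true T (vertices t)
vertices (_∷_ false {S = S} t) = extend false S (vertices t)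

vertices-between : ∀ {n} {S T : Subset n} (t : AddsTop S T) → ∀ j → S ≼ vertices t j × vertices t j ≼ T
vertices-between top zero = ≼-refl (false ∷ []) , addsTop⇒≼ top
vertices-between top (suc zero) = addsTop⇒≼ top , ≼-refl (true ∷ [])
vertices-between (_∷_ true {T = T} t) zero =
  ∷-≼ (≤-reflexive (sym (addsTop⇒oneMoreAbove t 0 (s≤s z≤n)))) (addsTop⇒≼ t) , ∷-≼ (n≤1+n _) (≼-refl T)
vertices-between (_∷_ false {S = S} t) zero =
  ∷-≼ (n≤1+n _) (≼-refl S) , ∷-≼ (≤-reflexive (sym (addsTop⇒oneMoreAbove t 0 (s≤s z≤n)))) (addsTop⇒≼ t)
vertices-between (true ∷ t) (suc j) =
  ∷-mono-≼ true (proj₁ (vertices-between t j)) , ∷-mono-≼ true (proj₂ (vertices-between t j))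
vertices-between (false ∷ t) (suc j) =
  ∷-mono-≼ false (proj₁ (vertices-between t j)) , ∷-mono-≼ false (proj₂ (vertices-between t j))

vertices-independent : ∀ {n} {S T : Subset n} (t : AddsTop S T) → AffinelyIndependent (vertices t)
vertices-independent top = extend-independent true [] {λ _ → []} (point-independent [])
vertices-independent (_∷_ true {T = T} t) = extend-independent true T {vertices t} (vertices-independent t)
vertices-independent (_∷_ false {S = S} t) = extend-independent false S {vertices t} (vertices-independent t)

feasible⇔between : ∀ {n} (S T R : Subset n) → Feasible S T R ⇔ (S ≼ R × R ≼ T)
feasible⇔between S T R = mk⇔
  (λ (S≤R , R≤T) → Equivalence.to (gale⇔≼ S R) S≤R , Equivalence.to (gale⇔≼ R T) R≤T)
  (λ (S≼R , R≼T) → Equivalence.from (gale⇔≼ S R) S≼R , Equivalence.from (gale⇔≼ R T) R≼T)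

addsTop⇒hasDim : ∀ {n} {S T : Subset n} → AddsTop S T → HasDim (Feasible S T) n
addsTop⇒hasDim {S = S} {T} t =
  ( vertices t
  , (λ j → Equivalence.from (feasible⇔between S T (vertices t j)) (vertices-between t j))
  , vertices-independent t) ,
  (λ v _ → n+2-points⇒¬independent ≤-refl v)

addsTop⇒rank : ∀ {n} {S T : Subset n} → AddsTop S T → rank T ≡ rank S + n
addsTop⇒rank {n} {S} {T} t = begin
    rank T
  ≡⟨ rank≡sum-countAbove T ⟩
    sum (λ (k : Fin n) → countAbove (toℕ k) T)
  ≡⟨ sum-cong-≗ (λ k → addsTop⇒oneMoreAbove t (toℕ k) (toℕ<n k)) ⟩
    sum (λ (k : Fin n) → suc (countAbove (toℕ k) S))
  ≡⟨ sum-suc {n} (λ k → countAbove (toℕ k) S) ⟩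
    sum (λ (k : Fin n) → countAbove (toℕ k) S) + n
  ≡⟨ cong (_+ n) (sym (rank≡sum-countAbove S)) ⟩
    rank S + n ∎
  where open ≡-Reasoning

hasDim-≤ : ∀ {n d} {F : Subset n → Set} → HasDim F d → d ≤ n
hasDim-≤ {n} {d} ((v , _ , independent) , _) with d ≤? n
... | yes d≤n = d≤n
... | no d≰n = contradiction independent (n+2-points⇒¬independent (s≤s (≰⇒> d≰n)) v)

-- every feasible set would lie on the hyperplane countAbove k = countAbove k S
linked⇒strict : ∀ {n} (S T : Subset n) → LinkedInterval S T → ∀ k → k < n → countAbove k S < countAbove k T
linked⇒strict S T ((v , feasible , independent) , _) k k<n with countAbove k S <? countAbove k T
... | yes S<T = S<T
... | no S≮T = contradiction independent (hyperplane⇒¬independent (fromℕ< k<n) (countAbove k S) v on-hyperplane-k)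
  where
  on-hyperplane-k : ∀ j → countAbove (toℕ (fromℕ< k<n)) (v j) ≡ countAbove k S
  on-hyperplane-k j rewrite toℕ-fromℕ< k<n =
    let (S≼v , v≼T) = Equivalence.to (feasible⇔between S T (v j)) (feasible j)
    in ≤-antisym (≤-trans (v≼T k) (≮⇒≥ S≮T)) (S≼v k)

linkedToric⇔addsTop : ∀ {m} (S T : Subset (suc m)) → (LinkedInterval S T × ToricInterval S T) ⇔ AddsTop S T
linkedToric⇔addsTop {m} S T = mk⇔ to from
  where
  n = suc m
  from : AddsTop S T → LinkedInterval S T × ToricInterval S T
  from t = addsTop⇒hasDim t , (n , addsTop⇒hasDim t , addsTop⇒rank t)
  to : LinkedInterval S T × ToricInterval S T → AddsTop S T
  to (linked , d , hasDim , rank≡) = oneMoreAbove⇒addsTop S T oneMore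
    where
    d≤n = hasDim-≤ {F = Feasible S T} hasDim
    f g : Fin n → ℕ
    f k = countAbove (toℕ k) S
    g k = countAbove (toℕ k) T
    ∑g≤∑f+n : sum g ≤ sum f + n
    ∑g≤∑f+n = begin
        sum g           ≡⟨ sym (rank≡sum-countAbove T) ⟩
        rank T          ≡⟨ rank≡ ⟩
        rank S + d      ≤⟨ +-monoʳ-≤ (rank S) d≤n ⟩
        rank S + n      ≡⟨ cong (_+ n) (rank≡sum-countAbove S) ⟩
        sum f + n       ∎
      where open ≤-Reasoning
    oneMore : OneMoreAbove S T
    oneMore k k<n = subst (λ k → countAbove k T ≡ suc (countAbove k S)) (toℕ-fromℕ< k<n)
      (sum-tight {n} f g (λ (k : Fin n) → linked⇒strict S T linked (toℕ k) (toℕ<n k)) ∑g≤∑f+n (fromℕ< k<n))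

-- Lattice paths

north : Step → ℕ
north E = 0
north N = 1

height width : ∀ {L} → Vec Step L → ℕ → ℕ
height p j = countN (take j (toList p))
width p j = countE (take j (toList p))

countE+countN : ∀ w → countE w + countN w ≡ length w
countE+countN [] = refl
countE+countN (E ∷ w) = cong suc (countE+countN w)
countE+countN (N ∷ w) = trans (+-suc (countE w) (countN w)) (cong suc (countE+countN w))

width+height : ∀ {L} (p : Vec Step L) j → j ≤ L → width p j + height p j ≡ j
width+height p j j≤L = begin
    width p j + height p j
  ≡⟨ countE+countN (take j (toList p)) ⟩
    length (take j (toList p))
  ≡⟨ length-take j (toList p) ⟩
    j ⊓ length (toList p)
  ≡⟨ m≤n⇒m⊓n≡m (subst (j ≤_) (sym (length-toList p)) j≤L) ⟩
    j ∎
  where open ≡-Reasoning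

height-suc : ∀ {L} (p : Vec Step L) (i : Fin L) → height p (suc (toℕ i)) ≡ height p (toℕ i) + north (lookup p i)
height-suc (E ∷ p) zero = refl
height-suc (N ∷ p) zero = refl
height-suc (E ∷ p) (suc i) = height-suc p i
height-suc (N ∷ p) (suc i) = cong suc (height-suc p i)

countN≡sum : ∀ {L} (p : Vec Step L) → countN (toList p) ≡ sum (λ i → north (lookup p i))
countN≡sum [] = refl
countN≡sum (E ∷ p) = countN≡sum p
countN≡sum (N ∷ p) = cong suc (countN≡sum p)

sum-ones : ∀ L → sum (λ (_ : Fin L) → 1) ≡ L
sum-ones zero = refl
sum-ones (suc L) = cong suc (sum-ones L)

opposite-< : ∀ {n} (i : Fin (n + n)) → n ≤ toℕ i → toℕ (opposite i) < n
opposite-< {n} i n≤i = subst (_< n) (sym (opposite-prop i)) (+-cancelʳ-≤ n (suc x) n (begin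
    suc x + n
  ≡⟨ sym (+-suc x n) ⟩
    x + suc n
  ≤⟨ +-monoʳ-≤ x (s≤s n≤i) ⟩
    x + suc (toℕ i)
  ≡⟨ m∸n+n≡m (toℕ<n i) ⟩
    n + n ∎))
  where
  open ≤-Reasoning
  x = n + n ∸ suc (toℕ i)

symmetric-all : ∀ {n} (p : Path n) → Symmetric {n} p → ∀ i → lookup p i ≢ lookup p (opposite i)
symmetric-all {n} p symmetric i with toℕ i <? n
... | yes i<n = symmetric i i<n
... | no i≮n = λ pᵢ≡pᵢ′ → symmetric (opposite i) (opposite-< i (≮⇒≥ i≮n))
  (trans (sym pᵢ≡pᵢ′) (cong (lookup p) (sym (opposite-involutive i))))

north-≢ : ∀ {x y} → x ≢ y → north x + north y ≡ 1
north-≢ {E} {E} x≢y = contradiction refl x≢y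
north-≢ {E} {N} _ = refl
north-≢ {N} {E} _ = refl
north-≢ {N} {N} x≢y = contradiction refl x≢y

half : ∀ {a n} → a + a ≡ n + n → a ≡ n
half {a} {n} a+a≡n+n = trans (n≡⌊n+n/2⌋ a) (trans (cong ⌊_/2⌋ a+a≡n+n) (sym (n≡⌊n+n/2⌋ n)))

flip : Step → Step
flip E = N
flip N = E

≢⇒flip : ∀ {x y} → x ≢ y → y ≡ flip x
≢⇒flip {E} {E} x≢y = contradiction refl x≢y
≢⇒flip {E} {N} _ = refl
≢⇒flip {N} {E} _ = refl
≢⇒flip {N} {N} x≢y = contradiction refl x≢y

symmetric-flip : ∀ {n} (p : Path n) → Symmetric {n} p → ∀ i → lookup p i ≡ flip (lookup p (opposite i))
symmetric-flip p symmetric i = ≢⇒flip (≢-sym (symmetric-all p symmetric i))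

-- each pair of opposite steps contributes exactly one N step
symmetric-countN : ∀ {n} (p : Path n) → Symmetric {n} p → countN (toList p) ≡ n
symmetric-countN {n} p symmetric = half (begin
    countN (toList p) + countN (toList p)
  ≡⟨ cong₂ _+_ (countN≡sum p) (trans (countN≡sum p) (∑-permute f Permutation.reverse)) ⟩
    sum f + sum (λ i → f (opposite i))
  ≡⟨ sym (∑-distrib-+ f (λ i → f (opposite i))) ⟩
    sum (λ i → f i + f (opposite i))
  ≡⟨ sum-cong-≗ (λ i → north-≢ (symmetric-all p symmetric i)) ⟩
    sum (λ (_ : Fin (n + n)) → 1)
  ≡⟨ sum-ones (n + n) ⟩
    n + n ∎)
  where
  open ≡-Reasoning
  f : Fin (n + n) → ℕ
  f i = north (lookup p i)

symmetric-countE : ∀ {n} (p : Path n) → Symmetric {n} p → countE (toList p) ≡ n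
symmetric-countE {n} p symmetric = +-cancelʳ-≡ n (countE (toList p)) n
  (trans (cong (countE (toList p) +_) (sym (symmetric-countN p symmetric)))
         (trans (countE+countN (toList p)) (length-toList p)))

height-end : ∀ {n} (p : Path n) → Symmetric {n} p → height p (n + n) ≡ n
height-end {n} p symmetric =
  trans (cong countN (take-all (n + n) (toList p) (≤-reflexive (length-toList p)))) (symmetric-countN p symmetric)

width-end : ∀ {n} (p : Path n) → Symmetric {n} p → width p (n + n) ≡ n
width-end {n} p symmetric =
  trans (cong countE (take-all (n + n) (toList p) (≤-reflexive (length-toList p)))) (symmetric-countE p symmetric)

colH-≤ : ∀ w j x → x < countE (take j w) → colH w x ≤ countN (take j w)
colH-≤ (E ∷ w) (suc j) zero _ = z≤n
colH-≤ (E ∷ w) (suc j) (suc x) (s≤s x<) = colH-≤ w j x x<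
colH-≤ (N ∷ w) (suc j) x x< = s≤s (colH-≤ w j x x<)

≤-colH : ∀ w j x → countE (take j w) ≤ x → countN (take j w) ≤ colH w x
≤-colH w zero x _ = z≤n
≤-colH [] (suc j) x _ = z≤n
≤-colH (E ∷ w) (suc j) (suc x) (s≤s ≤x) = ≤-colH w j x ≤x
≤-colH (N ∷ w) (suc j) x ≤x = s≤s (≤-colH w j x ≤x)

-- the time at which the path completes its (x + 1)-th E step, i.e. leaves column x
colH-reached : ∀ w x → x < countE w →
  ∃ λ j → j ≤ length w × countE (take j w) ≡ suc x × countN (take j w) ≡ colH w x
colH-reached (E ∷ w) zero _ = 1 , s≤s z≤n , refl , refl
colH-reached (E ∷ w) (suc x) (s≤s x<) with colH-reached w x x<
... | j , j≤ , widthⱼ , heightⱼ = suc j , s≤s j≤ , cong suc widthⱼ , heightⱼ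
colH-reached (N ∷ w) x x< with colH-reached w x x<
... | j , j≤ , widthⱼ , heightⱼ = suc j , s≤s j≤ , widthⱼ , cong suc heightⱼ

countE-take-≤ : ∀ j w → countE (take j w) ≤ countE w
countE-take-≤ zero w = z≤n
countE-take-≤ (suc j) [] = z≤n
countE-take-≤ (suc j) (E ∷ w) = s≤s (countE-take-≤ j w)
countE-take-≤ (suc j) (N ∷ w) = countE-take-≤ j w

Square : ∀ {n} → Path n → Path n → Set
Square {n} p q = Σ ℕ λ x → Σ ℕ λ y →
  InBox {n} p q x y × InBox {n} p q (suc x) y × InBox {n} p q x (suc y) × InBox {n} p q (suc x) (suc y)

AtMostOneAbove : ∀ {n} → Path n → Path n → Set
AtMostOneAbove {n} p q = ∀ j → j ≤ n + n → height q j ≤ suc (height p j)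

square : ∀ {n} (p q : Path n) x y → suc x < n →
  colH (toList p) x ≤ y → colH (toList p) (suc x) ≤ y →
  suc (suc y) ≤ colH (toList q) x → suc (suc y) ≤ colH (toList q) (suc x) → Square {n} p q
square p q x y x+1<n pₓ≤y pₓ₊₁≤y y+2≤qₓ y+2≤qₓ₊₁ = x , y ,
  (x<n , pₓ≤y , <⇒≤ y+2≤qₓ) , (x+1<n , pₓ₊₁≤y , <⇒≤ y+2≤qₓ₊₁) ,
  (x<n , m≤n⇒m≤1+n pₓ≤y , y+2≤qₓ) , (x+1<n , m≤n⇒m≤1+n pₓ₊₁≤y , y+2≤qₓ₊₁)
  where
  x<n = <-trans (n<1+n x) x+1<n

split-+2 : ∀ {m n} → m + 2 ≤ n → ∃ λ x → n ≡ suc (suc x) × m ≤ x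
split-+2 {m} {zero} m+2≤0 = contradiction (≤-trans (m≤n+m 2 m) m+2≤0) λ ()
split-+2 {m} {suc zero} m+2≤1 = contradiction (≤-trans (m≤n+m 2 m) m+2≤1) λ { (s≤s ()) }
split-+2 {m} {suc (suc x)} m+2≤x+2 = x , refl , +-cancelʳ-≤ 2 m x (subst (m + 2 ≤_) (+-comm 2 x) m+2≤x+2)

gap⇒wide : ∀ {L} (p q : Vec Step L) j → j ≤ L → height p j + 2 ≤ height q j → width q j + 2 ≤ width p j
gap⇒wide p q j j≤L a+2≤b = +-cancelʳ-≤ (height p j) (width q j + 2) (width p j) (begin
    width q j + 2 + height p j
  ≡⟨ +-assoc (width q j) 2 (height p j) ⟩
    width q j + (2 + height p j)
  ≤⟨ +-monoʳ-≤ (width q j) (subst (_≤ height q j) (+-comm (height p j) 2) a+2≤b) ⟩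
    width q j + height q j
  ≡⟨ trans (width+height q j j≤L) (sym (width+height p j j≤L)) ⟩
    width p j + height p j ∎)
  where open ≤-Reasoning

gap⇒square : ∀ {n} (p q : Path n) → countE (toList p) ≡ n → ∀ j → j ≤ n + n →
  height p j + 2 ≤ height q j → Square {n} p q
gap⇒square {n} p q widthₚ j j≤2n a+2≤b with split-+2 (gap⇒wide p q j j≤2n a+2≤b)
... | x , X≡x+2 , Y≤x = square {n} p q x a x+1<n
        (colH-≤ (toList p) j x (subst (x <_) (sym X≡x+2) (m<n⇒m<1+n (n<1+n x))))
        (colH-≤ (toList p) j (suc x) (subst (suc x <_) (sym X≡x+2) (n<1+n (suc x))))
        (≤-trans a+2≤b′ (≤-colH (toList q) j x Y≤x))
        (≤-trans a+2≤b′ (≤-colH (toList q) j (suc x) (m≤n⇒m≤1+n Y≤x)))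
  where
  a = height p j
  a+2≤b′ : suc (suc a) ≤ height q j
  a+2≤b′ = subst (_≤ height q j) (+-comm a 2) a+2≤b
  x+1<n : suc x < n
  x+1<n = subst (suc (suc x) ≤_) widthₚ (subst (_≤ countE (toList p)) X≡x+2 (countE-take-≤ j (toList p)))

snake⇒atMostOneAbove : ∀ {n} (p q : Path n) → countE (toList p) ≡ n → SnakePath {n} p q → AtMostOneAbove {n} p q
snake⇒atMostOneAbove {n} p q widthₚ snake j j≤2n with height q j ≤? suc (height p j)
... | yes b≤a+1 = b≤a+1
... | no b≰a+1 =
  contradiction (gap⇒square {n} p q widthₚ j j≤2n (subst (_≤ height q j) (+-comm 2 (height p j)) (≰⇒> b≰a+1))) snake

atMostOneAbove⇒snake : ∀ {n} (p q : Path n) → countE (toList p) ≡ n → AtMostOneAbove {n} p q → SnakePath {n} p q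
atMostOneAbove⇒snake {n} p q widthₚ atMostOneAbove (x , y , _ , (x+1<n , pₓ₊₁≤y , _) , (_ , _ , y+2≤qₓ) , _)
  with colH-reached (toList p) (suc x) (subst (suc x <_) (sym widthₚ) x+1<n)
... | j , j≤ , widthₚⱼ , heightₚⱼ = <-irrefl refl (≤-trans y+2≤qₓ (≤-trans qₓ≤b b≤y+1))
  where
  j≤2n : j ≤ n + n
  j≤2n = subst (j ≤_) (length-toList p) j≤
  a = height p j
  b≤a+1 : height q j ≤ suc a
  b≤a+1 = atMostOneAbove j j≤2n
  b≤y+1 : height q j ≤ suc y
  b≤y+1 = ≤-trans b≤a+1 (s≤s (subst (_≤ y) (sym heightₚⱼ) pₓ₊₁≤y))
  x<Y : x < width q j
  x<Y = +-cancelʳ-≤ (suc a) (suc x) (width q j) (begin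
      suc x + suc a
    ≡⟨ +-suc (suc x) a ⟩
      suc (suc x) + a
    ≡⟨ cong (_+ a) (sym widthₚⱼ) ⟩
      width p j + a
    ≡⟨ trans (width+height p j j≤2n) (sym (width+height q j j≤2n)) ⟩
      width q j + height q j
    ≤⟨ +-monoʳ-≤ (width q j) b≤a+1 ⟩
      width q j + suc a ∎)
    where open ≤-Reasoning
  qₓ≤b : colH (toList q) x ≤ height q j
  qₓ≤b = colH-≤ (toList q) j x x<Y

StrictlyAbove : ∀ {n} → Path n → Path n → Set
StrictlyAbove {n} p q = ∀ j → 0 < j → j < n + n → height p j < height q j

endpoint-or-interior : ∀ {L} j → j ≤ L → j ≡ 0 ⊎ j ≡ L ⊎ (0 < j × j < L)
endpoint-or-interior zero _ = inj₁ refl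
endpoint-or-interior {L} (suc j) j+1≤L with suc j <? L
... | yes j+1<L = inj₂ (inj₂ (s≤s z≤n , j+1<L))
... | no j+1≮L = inj₂ (inj₁ (≤-antisym j+1≤L (≮⇒≥ j+1≮L)))

point-sum : ∀ {n} (p : Path n) j → j ≤ n + n → ∀ {u v} → point {n} p j ≡ (u , v) → j ≡ u + v
point-sum {n} p j j≤2n pⱼ≡uv =
  trans (sym (width+height p j j≤2n)) (cong₂ _+_ (cong proj₁ pⱼ≡uv) (cong proj₂ pⱼ≡uv))

linked⇒strictlyAbove : ∀ {n} (p q : Path n) → _≤P_ {n} p q → LinkedPaths {n} p q → StrictlyAbove {n} p q
linked⇒strictlyAbove {n} p q p≤q linked j 0<j j<2n = ≤∧≢⇒< (p≤q j j≤2n) heights-differ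
  where
  j≤2n = <⇒≤ j<2n
  heights-differ : height p j ≢ height q j
  heights-differ a≡b with linked j j j≤2n j≤2n (cong₂ _,_ widths-agree a≡b)
    where
    widths-agree : width p j ≡ width q j
    widths-agree = +-cancelʳ-≡ (height p j) (width p j) (width q j)
      (trans (width+height p j j≤2n) (sym (trans (cong (width q j +_) a≡b) (width+height q j j≤2n))))
  ... | inj₁ pⱼ≡00 = <-irrefl (sym (point-sum {n} p j j≤2n pⱼ≡00)) 0<j
  ... | inj₂ pⱼ≡nn = <-irrefl (point-sum {n} p j j≤2n pⱼ≡nn) j<2n

strictlyAbove⇒linked : ∀ {n} (p q : Path n) → Symmetric {n} p → StrictlyAbove {n} p q → LinkedPaths {n} p q
strictlyAbove⇒linked {n} p q symmetric strictlyAbove j k j≤2n k≤2n pⱼ≡qₖ with endpoint-or-interior j j≤2n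
... | inj₁ refl = inj₁ refl
... | inj₂ (inj₁ refl) = inj₂ (cong₂ _,_ (width-end p symmetric) (height-end p symmetric))
... | inj₂ (inj₂ (0<j , j<2n)) = contradiction heights-agree (<⇒≢ (strictlyAbove j 0<j j<2n))
  where
  j≡k : j ≡ k
  j≡k = trans (point-sum {n} p j j≤2n refl)
              (trans (cong (λ (u , v) → u + v) pⱼ≡qₖ) (sym (point-sum {n} q k k≤2n refl)))
  heights-agree : height p j ≡ height q j
  heights-agree = trans (cong proj₂ pⱼ≡qₖ) (cong (height q) (sym j≡k))

OneAbove : ∀ {n} → Path n → Path n → Set
OneAbove {n} p q = ∀ j → 0 < j → j < n + n → height q j ≡ suc (height p j)

linkedSnake⇔oneAbove : ∀ {n} (p q : Path n) → Symmetric {n} p → Symmetric {n} q → _≤P_ {n} p q →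
  (LinkedPaths {n} p q × SnakePath {n} p q) ⇔ OneAbove {n} p q
linkedSnake⇔oneAbove {n} p q p-symmetric q-symmetric p≤q = mk⇔
  (λ (linked , snake) j 0<j j<2n →
     ≤-antisym (snake⇒atMostOneAbove {n} p q (symmetric-countE p p-symmetric) snake j (<⇒≤ j<2n))
               (linked⇒strictlyAbove {n} p q p≤q linked j 0<j j<2n))
  (λ oneAbove →
     strictlyAbove⇒linked {n} p q p-symmetric (λ j 0<j j<2n → ≤-reflexive (sym (oneAbove j 0<j j<2n))) ,
     atMostOneAbove⇒snake {n} p q (symmetric-countE p p-symmetric) (atMostOneAbove oneAbove))
  where
  atMostOneAbove : OneAbove {n} p q → AtMostOneAbove {n} p q
  atMostOneAbove oneAbove j j≤2n with endpoint-or-interior j j≤2n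
  ... | inj₁ refl = z≤n
  ... | inj₂ (inj₁ refl) =
    subst₂ _≤_ (sym (height-end q q-symmetric)) (cong suc (sym (height-end p p-symmetric))) (n≤1+n n)
  ... | inj₂ (inj₂ (0<j , j<2n)) = ≤-reflexive (oneAbove j 0<j j<2n)

record SwapsEnds {n} (p q : Path n) : Set where
  field
    first  : ∀ i → toℕ i ≡ 0 → lookup p i ≡ E × lookup q i ≡ N
    middle : ∀ i → 0 < toℕ i → suc (toℕ i) < n + n → lookup p i ≡ lookup q i
    last   : ∀ i → suc (toℕ i) ≡ n + n → lookup p i ≡ N × lookup q i ≡ E

north-suc : ∀ {x y} → north y ≡ suc (north x) → x ≡ E × y ≡ N
north-suc {E} {N} _ = refl , refl

north-injective : ∀ {x y} → north x ≡ north y → x ≡ y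
north-injective {E} {E} _ = refl
north-injective {N} {N} _ = refl

height-suc-at : ∀ {L} (p : Vec Step L) t (t<L : t < L) →
  height p (suc t) ≡ height p t + north (lookup p (fromℕ< t<L))
height-suc-at p t t<L =
  subst (λ s → height p (suc s) ≡ height p s + north (lookup p (fromℕ< t<L)))
        (toℕ-fromℕ< t<L) (height-suc p (fromℕ< t<L))

swapsEnds⇒oneAbove : ∀ {n} (p q : Path n) → SwapsEnds {n} p q → OneAbove {n} p q
swapsEnds⇒oneAbove {n} p q swaps zero () _
swapsEnds⇒oneAbove {n} p q swaps (suc t) _ j<2n = go t j<2n
  where
  open SwapsEnds swaps
  open ≡-Reasoning
  go : ∀ t → suc t < n + n → height q (suc t) ≡ suc (height p (suc t))
  go zero 1<2n = begin
      height q 1                  ≡⟨ height-suc-at q 0 0<2n ⟩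
      north (lookup q i)          ≡⟨ cong north (proj₂ (first i (toℕ-fromℕ< 0<2n))) ⟩
      1                           ≡⟨ cong (λ s → suc (north s)) (sym (proj₁ (first i (toℕ-fromℕ< 0<2n)))) ⟩
      suc (north (lookup p i))    ≡⟨ cong suc (sym (height-suc-at p 0 0<2n)) ⟩
      suc (height p 1)            ∎
    where
    0<2n = <-trans (n<1+n 0) 1<2n
    i = fromℕ< 0<2n
  go (suc t) t+2<2n = begin
      height q (suc (suc t))
    ≡⟨ height-suc-at q (suc t) t+1<2n ⟩
      height q (suc t) + north (lookup q i)
    ≡⟨ cong₂ _+_ (go t (<-trans (n<1+n (suc t)) t+2<2n)) (cong north (sym (middle i 0<i i+1<2n))) ⟩
      suc (height p (suc t) + north (lookup p i))
    ≡⟨ cong suc (sym (height-suc-at p (suc t) t+1<2n)) ⟩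
      suc (height p (suc (suc t))) ∎
    where
    t+1<2n = <-trans (n<1+n (suc t)) t+2<2n
    i = fromℕ< t+1<2n
    0<i : 0 < toℕ i
    0<i = subst (0 <_) (sym (toℕ-fromℕ< t+1<2n)) (s≤s z≤n)
    i+1<2n : suc (toℕ i) < n + n
    i+1<2n = subst (λ s → suc s < n + n) (sym (toℕ-fromℕ< t+1<2n)) t+2<2n

oneAbove⇒swapsEnds : ∀ {m} (p q : Path (suc m)) → Symmetric {suc m} p → Symmetric {suc m} q →
  OneAbove {suc m} p q → SwapsEnds {suc m} p q
oneAbove⇒swapsEnds {m} p q p-symmetric q-symmetric oneAbove = record
  { first = λ i i≡0 → subst (λ i → lookup p i ≡ E × lookup q i ≡ N) (sym (toℕ-injective {j = zero} i≡0)) first₀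
  ; middle = middle
  ; last = last
  }
  where
  n = suc m
  1<2n : 1 < n + n
  1<2n = s≤s (≤-trans (s≤s z≤n) (m≤n+m (suc m) m))
  first₀ : lookup p zero ≡ E × lookup q zero ≡ N
  first₀ = north-suc (trans (sym (height-suc q zero)) (trans (oneAbove 1 (s≤s z≤n) 1<2n) (cong suc (height-suc p zero))))
  middle : ∀ i → 0 < toℕ i → suc (toℕ i) < n + n → lookup p i ≡ lookup q i
  middle i 0<i i+1<2n = north-injective (+-cancelˡ-≡ (suc (height p t)) (north (lookup p i)) (north (lookup q i)) (begin
      suc (height p t) + north (lookup p i)
    ≡⟨ cong suc (sym (height-suc p i)) ⟩
      suc (height p (suc t))
    ≡⟨ sym (oneAbove (suc t) (s≤s z≤n) i+1<2n) ⟩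
      height q (suc t)
    ≡⟨ height-suc q i ⟩
      height q t + north (lookup q i)
    ≡⟨ cong (_+ north (lookup q i)) (oneAbove t 0<i (<-trans (n<1+n t) i+1<2n)) ⟩
      suc (height p t) + north (lookup q i) ∎))
    where
    open ≡-Reasoning
    t = toℕ i
  last : ∀ i → suc (toℕ i) ≡ n + n → lookup p i ≡ N × lookup q i ≡ E
  last i i+1≡2n =
    subst (λ i → lookup p i ≡ N × lookup q i ≡ E) opposite₀≡i
      ( trans (≢⇒flip (p-symmetric zero (s≤s z≤n))) (cong flip (proj₁ first₀))
      , trans (≢⇒flip (q-symmetric zero (s≤s z≤n))) (cong flip (proj₂ first₀)))
    where
    opposite₀≡i : opposite zero ≡ i
    opposite₀≡i = toℕ-injective (trans (opposite-prop {n + n} zero) (cong (_∸ 1) (sym i+1≡2n)))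

oneAbove⇔swapsEnds : ∀ {m} (p q : Path (suc m)) → Symmetric {suc m} p → Symmetric {suc m} q →
  OneAbove {suc m} p q ⇔ SwapsEnds {suc m} p q
oneAbove⇔swapsEnds p q p-symmetric q-symmetric =
  mk⇔ (oneAbove⇒swapsEnds p q p-symmetric q-symmetric) (swapsEnds⇒oneAbove p q)

labelOf-↑ʳ : ∀ {n} (j : Fin n) → labelOf {n} (n ↑ʳ j) ≡ ℤ.+ suc (toℕ j)
labelOf-↑ʳ {n} j with toℕ (n ↑ʳ j) <? n
... | yes n+j<n = contradiction (subst (_< n) (toℕ-↑ʳ n j) n+j<n) (m+n≮m n (toℕ j))
... | no _ = cong (λ k → ℤ.+ suc k) (trans (cong (_∸ n) (toℕ-↑ʳ n j)) (m+n∸m≡n n (toℕ j)))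

labelOf-positive : ∀ {n} (i : Fin (n + n)) (j : Fin n) → labelOf {n} i ≡ ℤ.+ suc (toℕ j) → i ≡ n ↑ʳ j
labelOf-positive {n} i j labelᵢ≡j+1 with toℕ i <? n
... | yes _ = contradiction labelᵢ≡j+1 λ ()
... | no i≮n = toℕ-injective (begin
    toℕ i              ≡⟨ sym (m+[n∸m]≡n (≮⇒≥ i≮n)) ⟩
    n + (toℕ i ∸ n)    ≡⟨ cong (λ k → n + k) (suc-injective (ℤ.+-injective labelᵢ≡j+1)) ⟩
    n + toℕ j          ≡⟨ sym (toℕ-↑ʳ n j) ⟩
    toℕ (n ↑ʳ j)       ∎)
  where open ≡-Reasoning

∈-labL⇔ : ∀ {n} (p : Path n) (j : Fin n) → (ℤ.+ suc (toℕ j) ∈ labL {n} p) ⇔ (lookup p (n ↑ʳ j) ≡ E)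
∈-labL⇔ {n} p j = mk⇔ to from
  where
  labels : Fin (n + n) → List ℤ
  labels i = if isE (lookup p i) then labelOf {n} i ∷ [] else []
  to : ℤ.+ suc (toℕ j) ∈ labL {n} p → lookup p (n ↑ʳ j) ≡ E
  to j+1∈labL with satisfied (∈-concatMap⁻ labels {xs = allFin (n + n)} j+1∈labL)
  ... | i , j+1∈labelsᵢ = step (lookup p i) refl j+1∈labelsᵢ
    where
    step : ∀ s → lookup p i ≡ s → ℤ.+ suc (toℕ j) ∈ (if isE s then labelOf {n} i ∷ [] else []) →
           lookup p (n ↑ʳ j) ≡ E
    step E pᵢ≡E (here j+1≡labelᵢ) = trans (cong (lookup p) (sym (labelOf-positive i j (sym j+1≡labelᵢ)))) pᵢ≡E
  from : lookup p (n ↑ʳ j) ≡ E → ℤ.+ suc (toℕ j) ∈ labL {n} p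
  from pₙ₊ⱼ≡E = ∈-concatMap⁺ labels (lose (∈-allFin (n ↑ʳ j)) j+1∈labels)
    where
    j+1∈labels : ℤ.+ suc (toℕ j) ∈ labels (n ↑ʳ j)
    j+1∈labels rewrite pₙ₊ⱼ≡E = here (sym (labelOf-↑ʳ j))

labSet-lookup : ∀ {n} (p : Path n) (j : Fin n) → lookup (labSet {n} p) j ≡ isE (lookup p (n ↑ʳ j))
labSet-lookup {n} p j = trans (lookup∘tabulate _ j) (decide (lookup p (n ↑ʳ j)) refl)
  where
  decide : ∀ s → lookup p (n ↑ʳ j) ≡ s → does (ℤ.+ suc (toℕ j) ∈? labL {n} p) ≡ isE s
  decide E pₙ₊ⱼ≡E = dec-true (_ ∈? _) (Equivalence.from (∈-labL⇔ p j) pₙ₊ⱼ≡E)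
  decide N pₙ₊ⱼ≡N = dec-false (_ ∈? _)
    (λ j+1∈labL → contradiction (trans (sym pₙ₊ⱼ≡N) (Equivalence.to (∈-labL⇔ p j) j+1∈labL)) λ ())

record TopOnlyDifference {m} (S T : Subset (suc m)) : Set where
  field
    below : ∀ j → toℕ j < m → lookup S j ≡ lookup T j
    at-top : ∀ j → toℕ j ≡ m → lookup S j ≡ false × lookup T j ≡ true

addsTop⇔topOnlyDifference : ∀ {m} (S T : Subset (suc m)) → AddsTop S T ⇔ TopOnlyDifference S T
addsTop⇔topOnlyDifference S T = mk⇔ to from
  where
  to : ∀ {m} {S T : Subset (suc m)} → AddsTop S T → TopOnlyDifference S T
  to top = record { below = λ _ () ; at-top = λ { zero _ → refl , refl } }
  to (b ∷ t) = record
    { below = λ { zero _ → refl ; (suc j) (s≤s j<m) → TopOnlyDifference.below (to t) j j<m }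
    ; at-top = λ { (suc j) j+1≡m → TopOnlyDifference.at-top (to t) j (suc-injective j+1≡m) }
    }
  from : ∀ {m} {S T : Subset (suc m)} → TopOnlyDifference S T → AddsTop S T
  from {zero} {s ∷ []} {t ∷ []} d with TopOnlyDifference.at-top d zero refl
  ... | refl , refl = top
  from {suc m} {s ∷ S} {t ∷ T} d with TopOnlyDifference.below d zero (s≤s z≤n)
  ... | refl = s ∷ from record
    { below = λ j j<m → TopOnlyDifference.below d (suc j) (s≤s j<m)
    ; at-top = λ j j≡m → TopOnlyDifference.at-top d (suc j) (cong suc j≡m)
    }

halves : ∀ {n} (P : Fin (n + n) → Set) → (∀ j → P (j ↑ˡ n)) → (∀ j → P (n ↑ʳ j)) → ∀ i → P i
halves {n} P first second i = subst P (join-splitAt n n i) (by-half (splitAt n i))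
  where
  by-half : ∀ s → P (join n n s)
  by-half (inj₁ j) = first j
  by-half (inj₂ j) = second j

opposite-↑ˡ : ∀ {n} (j : Fin n) → opposite (j ↑ˡ n) ≡ n ↑ʳ opposite j
opposite-↑ˡ {n} j = toℕ-injective (begin
    toℕ (opposite (j ↑ˡ n))      ≡⟨ opposite-prop (j ↑ˡ n) ⟩
    n + n ∸ suc (toℕ (j ↑ˡ n))   ≡⟨ cong (λ t → n + n ∸ suc t) (toℕ-↑ˡ j n) ⟩
    n + n ∸ suc (toℕ j)          ≡⟨ +-∸-assoc n (toℕ<n j) ⟩
    n + (n ∸ suc (toℕ j))        ≡⟨ cong (λ t → n + t) (sym (opposite-prop j)) ⟩
    n + toℕ (opposite j)         ≡⟨ sym (toℕ-↑ʳ n (opposite j)) ⟩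
    toℕ (n ↑ʳ opposite j)        ∎)
  where open ≡-Reasoning

suc-toℕ-↑ʳ : ∀ n {m} (j : Fin m) → suc (toℕ (n ↑ʳ j)) ≡ n + suc (toℕ j)
suc-toℕ-↑ʳ n j = trans (cong suc (toℕ-↑ʳ n j)) (sym (+-suc n (toℕ j)))

isE-injective : ∀ {x y} → isE x ≡ isE y → x ≡ y
isE-injective {E} {E} _ = refl
isE-injective {N} {N} _ = refl

symmetric-↑ˡ : ∀ {n} (r : Path n) → Symmetric {n} r → ∀ j → lookup r (j ↑ˡ n) ≡ flip (lookup r (n ↑ʳ opposite j))
symmetric-↑ˡ {n} r symmetric j =
  trans (symmetric-flip r symmetric (j ↑ˡ n)) (cong (λ i → flip (lookup r i)) (opposite-↑ˡ j))

swapsEnds⇒topOnlyDifference : ∀ {m} (p q : Path (suc m)) →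
  SwapsEnds {suc m} p q → TopOnlyDifference (labSet {suc m} p) (labSet {suc m} q)
swapsEnds⇒topOnlyDifference {m} p q swaps = record
  { below = λ j j<m → trans (labSet-lookup p j) (trans (cong isE (middle (n ↑ʳ j) (0<n+j j) (interior j j<m)))
                                                       (sym (labSet-lookup q j)))
  ; at-top = λ j j≡m → let (pₙ₊ⱼ≡N , qₙ₊ⱼ≡E) = last (n ↑ʳ j) (trans (suc-toℕ-↑ʳ n j) (cong (λ t → n + suc t) j≡m))
                       in trans (labSet-lookup p j) (cong isE pₙ₊ⱼ≡N) , trans (labSet-lookup q j) (cong isE qₙ₊ⱼ≡E)
  }
  where
  open SwapsEnds swaps
  n = suc m
  0<n+j : ∀ j → 0 < toℕ (n ↑ʳ j)
  0<n+j j = subst (0 <_) (sym (toℕ-↑ʳ n j)) (s≤s z≤n)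
  interior : ∀ j → toℕ j < m → suc (toℕ (n ↑ʳ j)) < n + n
  interior j j<m = subst (_< n + n) (sym (suc-toℕ-↑ʳ n j)) (+-monoʳ-< n (s≤s j<m))

-- the first half of a symmetric path is determined by the second half
topOnlyDifference⇒swapsEnds : ∀ {m} (p q : Path (suc m)) → Symmetric {suc m} p → Symmetric {suc m} q →
  TopOnlyDifference (labSet {suc m} p) (labSet {suc m} q) → SwapsEnds {suc m} p q
topOnlyDifference⇒swapsEnds {m} p q p-symmetric q-symmetric difference = record
  { first = halves {n} (λ i → toℕ i ≡ 0 → lookup p i ≡ E × lookup q i ≡ N) first-left first-right
  ; middle = halves {n} (λ i → 0 < toℕ i → suc (toℕ i) < n + n → lookup p i ≡ lookup q i) middle-left middle-right
  ; last = halves {n} (λ i → suc (toℕ i) ≡ n + n → lookup p i ≡ N × lookup q i ≡ E) last-left last-right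
  }
  where
  open TopOnlyDifference difference
  n = suc m
  second-below : ∀ j → toℕ j < m → lookup p (n ↑ʳ j) ≡ lookup q (n ↑ʳ j)
  second-below j j<m = isE-injective (trans (sym (labSet-lookup p j)) (trans (below j j<m) (labSet-lookup q j)))
  second-top : ∀ j → toℕ j ≡ m → lookup p (n ↑ʳ j) ≡ N × lookup q (n ↑ʳ j) ≡ E
  second-top j j≡m = isE-injective (trans (sym (labSet-lookup p j)) (proj₁ (at-top j j≡m))) ,
                     isE-injective (trans (sym (labSet-lookup q j)) (proj₂ (at-top j j≡m)))

  first-left : ∀ j → toℕ (j ↑ˡ n) ≡ 0 → lookup p (j ↑ˡ n) ≡ E × lookup q (j ↑ˡ n) ≡ N
  first-left j j≡0 = trans (symmetric-↑ˡ p p-symmetric j) (cong flip (proj₁ (second-top (opposite j) opposite≡m))) ,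
                     trans (symmetric-↑ˡ q q-symmetric j) (cong flip (proj₂ (second-top (opposite j) opposite≡m)))
    where
    opposite≡m : toℕ (opposite j) ≡ m
    opposite≡m = trans (opposite-prop j) (cong (λ t → n ∸ suc t) (trans (sym (toℕ-↑ˡ j n)) j≡0))
  first-right : ∀ j → toℕ (n ↑ʳ j) ≡ 0 → lookup p (n ↑ʳ j) ≡ E × lookup q (n ↑ʳ j) ≡ N
  first-right j n+j≡0 = contradiction (trans (sym (toℕ-↑ʳ n j)) n+j≡0) λ ()

  middle-left : ∀ j → 0 < toℕ (j ↑ˡ n) → suc (toℕ (j ↑ˡ n)) < n + n → lookup p (j ↑ˡ n) ≡ lookup q (j ↑ˡ n)
  middle-left j 0<j _ = trans (symmetric-↑ˡ p p-symmetric j)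
    (trans (cong flip (second-below (opposite j) opposite<m)) (sym (symmetric-↑ˡ q q-symmetric j)))
    where
    opposite<m : toℕ (opposite j) < m
    opposite<m = subst (_< m) (sym (opposite-prop j))
                       (∸-monoʳ-< (subst (0 <_) (toℕ-↑ˡ j n) 0<j) (s≤s⁻¹ (toℕ<n j)))
  middle-right : ∀ j → 0 < toℕ (n ↑ʳ j) → suc (toℕ (n ↑ʳ j)) < n + n → lookup p (n ↑ʳ j) ≡ lookup q (n ↑ʳ j)
  middle-right j _ n+j+1<2n =
    second-below j (s≤s⁻¹ (+-cancelˡ-< n (suc (toℕ j)) (suc m) (subst (_< n + n) (suc-toℕ-↑ʳ n j) n+j+1<2n)))

  last-left : ∀ j → suc (toℕ (j ↑ˡ n)) ≡ n + n → lookup p (j ↑ˡ n) ≡ N × lookup q (j ↑ˡ n) ≡ E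
  last-left j j+1≡2n = contradiction
    (≤-trans (m<m+n n (s≤s z≤n)) (subst (_≤ n) (trans (cong suc (sym (toℕ-↑ˡ j n))) j+1≡2n) (toℕ<n j)))
    (<-irrefl refl)
  last-right : ∀ j → suc (toℕ (n ↑ʳ j)) ≡ n + n → lookup p (n ↑ʳ j) ≡ N × lookup q (n ↑ʳ j) ≡ E
  last-right j n+j+1≡2n =
    second-top j (suc-injective (+-cancelˡ-≡ n (suc (toℕ j)) (suc m) (trans (sym (suc-toℕ-↑ʳ n j)) n+j+1≡2n)))

swapsEnds⇔topOnlyDifference : ∀ {m} (p q : Path (suc m)) → Symmetric {suc m} p → Symmetric {suc m} q →
  SwapsEnds {suc m} p q ⇔ TopOnlyDifference (labSet {suc m} p) (labSet {suc m} q)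
swapsEnds⇔topOnlyDifference p q p-symmetric q-symmetric =
  mk⇔ (swapsEnds⇒topOnlyDifference p q) (topOnlyDifference⇒swapsEnds p q p-symmetric q-symmetric)

linkedToric-empty : LinkedInterval {0} [] [] × ToricInterval {0} [] []
linkedToric-empty = hasDim , 0 , hasDim , refl
  where
  hasDim : HasDim (Feasible {0} [] []) 0
  hasDim = ((λ _ → []) , (λ _ → nil , nil) , point-independent []) , (λ v _ → n+2-points⇒¬independent ≤-refl v)

linkedSnake-empty : (p q : Path 0) → LinkedPaths {0} p q × SnakePath {0} p q
linkedSnake-empty p q = (λ { _ _ z≤n _ _ → inj₁ refl }) , λ { (_ , _ , (() , _) , _) }

proposition5p5 : (n : ℕ) (p q : Path n) → Symmetric {n} p → Symmetric {n} q → _≤P_ {n} p q →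
    (LinkedInterval (labSet {n} p) (labSet {n} q) × ToricInterval (labSet {n} p) (labSet {n} q))
    ⇔ (LinkedPaths {n} p q × SnakePath {n} p q)
proposition5p5 zero p q _ _ _ = mk⇔ (λ _ → linkedSnake-empty p q) (λ _ → linkedToric-empty)
proposition5p5 (suc m) p q p-symmetric q-symmetric p≤q = begin
    (LinkedInterval S T × ToricInterval S T)  ≈⟨ linkedToric⇔addsTop S T ⟩
    AddsTop S T                               ≈⟨ addsTop⇔topOnlyDifference S T ⟩
    TopOnlyDifference S T                     ≈⟨ swapsEnds⇔topOnlyDifference p q p-symmetric q-symmetric ⟨
    SwapsEnds {n} p q                         ≈⟨ oneAbove⇔swapsEnds p q p-symmetric q-symmetric ⟨
    OneAbove {n} p q                          ≈⟨ linkedSnake⇔oneAbove p q p-symmetric q-symmetric p≤q ⟨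
    (LinkedPaths {n} p q × SnakePath {n} p q) ∎
  where
  open SetoidReasoning (⇔-setoid 0ℓ)
  n = suc m
  S = labSet {n} p
  T = labSet {n} q
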